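{- If $n$ is a positive integer satisfying $$\frac{2n}{n + 1} \leq \frac{\sigma(n)}{n} < 2,$$ then $\sigma(n) = 2n - 1$.
   Context: $\sigma(n)$ denotes the sum of all positive divisors of $n$. A positive integer $n$ is called almost perfect if $\sigma(n) = 2n-1$. -}

module Defs where

open import Data.Nat using (ℕ; zero; suc; _+_)
open import Data.Nat.Divisibility using (_∣?_)
open import Data.List using (List; filter; upTo; map)
open import Data.Nat.ListAction using (sum)

-- σ n = sum of the positive divisors of n, i.e. of all d with 1 ≤ d ≤ n and d ∣ n.
-- (σ 0 = 0 by this definition; only positive n are used.)
divisors : ℕ → List ℕ
divisors n = filter (_∣? n) (map suc (upTo n))

σ : ℕ → ℕ
σ n = sum (divisors n)

{-# OPTIONS --safe #-}
module Submission where

-- Only the two inequalities matter, not the divisor sum: if s ≤ 2n − 2 then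
-- s(n+1) ≤ (2n − 2)(n + 1) = 2n² − 2 < 2n², contradicting the lower bound.
-- Hence 2n − 1 ≤ s < 2n.

open import Defs
open import Data.Nat using (ℕ; suc; _+_; _*_; _∸_; _≤_; _<_; _≤?_)
open import Data.Nat.Properties
  using (≤-antisym; ≤-pred; <⇒≱; ≰⇒>; *-monoˡ-≤; +-cancelʳ-<; n<1+n; n≤1+n; module ≤-Reasoning)
open import Relation.Binary.PropositionalEquality using (_≡_; refl; cong)
open import Relation.Nullary using (yes; no; contradiction)
open import Data.Nat.Solver using (module +-*-Solver)
open +-*-Solver using (solve; _:+_; _:*_; _:=_; con)

product-below-double-square : ∀ s n → 2 + s ≤ 2 * n → s * (n + 1) < 2 * n * n
product-below-double-square s n 2+s≤2n = +-cancelʳ-< (2 * n) (s * (n + 1)) (2 * n * n) (begin-strict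
  s * (n + 1) + 2 * n          <⟨ n<1+n _ ⟩
  1 + (s * (n + 1) + 2 * n)    ≤⟨ n≤1+n _ ⟩
  2 + (s * (n + 1) + 2 * n)    ≡⟨ expand s n ⟩
  (2 + s) * (n + 1)            ≤⟨ *-monoˡ-≤ (n + 1) 2+s≤2n ⟩
  2 * n * (n + 1)              ≡⟨ expand-double n ⟩
  2 * n * n + 2 * n            ∎)
  where
  open ≤-Reasoning
  expand : ∀ s n → 2 + (s * (n + 1) + 2 * n) ≡ (2 + s) * (n + 1)
  expand = solve 2 (λ s n → con 2 :+ (s :* (n :+ con 1) :+ con 2 :* n)
                          := (con 2 :+ s) :* (n :+ con 1)) refl
  expand-double : ∀ n → 2 * n * (n + 1) ≡ 2 * n * n + 2 * n
  expand-double = solve 1 (λ n → con 2 :* n :* (n :+ con 1)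
                              := con 2 :* n :* n :+ con 2 :* n) refl

double-square-bound : ∀ s n → 2 * n * n ≤ s * (n + 1) → 2 * n ≤ suc s
double-square-bound s n lower with 2 + s ≤? 2 * n
... | yes 2+s≤2n = contradiction lower (<⇒≱ (product-below-double-square s n 2+s≤2n))
... | no 2+s≰2n = ≤-pred (≰⇒> 2+s≰2n)

lemma1 : (n : ℕ) → 1 ≤ n →
         2 * n * n ≤ σ n * (n + 1) →
         σ n < 2 * n →
         σ n ≡ 2 * n ∸ 1
lemma1 n _ lower upper =
  cong (_∸ 1) (≤-antisym upper (double-square-bound (σ n) n lower))
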